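{- Let $g(x)=\sum_{n\ge 1}\frac{2\,(4n+1)!}{(n+1)!\,(3n+2)!}\,x^n$ be a formal power series. Then for all integers $n\ge 1$, $$\frac{[x^n]\,(g(x))^2}{[x^n]\,g(x)}=\frac{10(n-1)(n^2+14n+12)}{3(3n+5)(3n+4)(n+2)}.$$
   Context: For a formal power series $f(x)$, $[x^n]f(x)$ denotes the coefficient of $x^n$ in $f(x)$. -}

module Defs where

open import Data.Nat as ℕ using (ℕ; zero; suc)
open import Data.Nat using (_!)
open import Data.Integer as ℤ using (ℤ; +_)
open import Data.Rational as ℚ using (ℚ; 0ℚ; _/_)
open import Data.List using (List; map; sum; upTo)
open import Data.Nat.Properties as NP using (_!*_!≢0)
import Data.List

gCoeff : ℕ → ℚ
gCoeff zero = 0ℚ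
gCoeff n@(suc _) =
  (+ (2 ℕ.* (4 ℕ.* n ℕ.+ 1) !)) / ((n ℕ.+ 1) ! ℕ.* (3 ℕ.* n ℕ.+ 2) !)
    where instance _ = (n ℕ.+ 1) NP.!* (3 ℕ.* n ℕ.+ 2) !≢0

gSqCoeff : ℕ → ℚ
gSqCoeff n = sum' (map (λ k → gCoeff k ℚ.* gCoeff (n ℕ.∸ k)) (upTo (suc n)))
  where
  sum' : List ℚ → ℚ
  sum' = Data.List.foldr ℚ._+_ 0ℚ

rhsRatio : ℕ → ℚ
rhsRatio n =
  (+ (10 ℕ.* (n ℕ.∸ 1) ℕ.* (n ℕ.* n ℕ.+ 14 ℕ.* n ℕ.+ 12)))
    / (3 ℕ.* (3 ℕ.* n ℕ.+ 5) ℕ.* (3 ℕ.* n ℕ.+ 4) ℕ.* (n ℕ.+ 2))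
  where
  nz : ∀ m k → ℕ.NonZero (m ℕ.+ suc k)
  nz m k rewrite NP.+-suc m k = _
  instance
    _ = NP.m*n≢0 (3 ℕ.* (3 ℕ.* n ℕ.+ 5) ℕ.* (3 ℕ.* n ℕ.+ 4)) (n ℕ.+ 2)
          {{NP.m*n≢0 (3 ℕ.* (3 ℕ.* n ℕ.+ 5)) (3 ℕ.* n ℕ.+ 4)
             {{NP.m*n≢0 3 (3 ℕ.* n ℕ.+ 5) {{_}} {{nz (3 ℕ.* n) 4}}}} {{nz (3 ℕ.* n) 3}}}}
          {{nz n 1}}

-- Let t₀ = 1 and tₙ = 2(4n+1)!/((n+1)!(3n+2)!) for n ≥ 1, so that tₙ = [xⁿ](1 + g) and, for n ≥ 1,
-- uₙ := [xⁿ](1 + g)² = Σₖ tₖ tₙ₋ₖ = [xⁿ]g² + 2[xⁿ]g.  The claim thus becomes the closed form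
-- Q(n) uₙ = P(n) tₙ with Q(n) = 3(3n+5)(3n+4)(n+2) and P(n) = 10(n−1)(n²+14n+12) + 2Q(n).
--
-- The term t is hypergeometric: t(n+1)(n+2)(3n+3)(3n+4)(3n+5) = t(n)(4n+2)(4n+3)(4n+4)(4n+5).
-- Creative telescoping (Zeilberger's algorithm) for the summand F(n,k) = tₖ tₙ₋ₖ yields polynomials
-- A₀, A₁, A₂ and G(n,k) = Γ(k, n+1−k) tₖ eₙ₊₁₋ₖ, where eₘ = tₘ/((m+2)(3m+4)(3m+5)), such that
--   A₀(n) F(n,k) + A₁(n) F(n+1,k) + A₂(n) F(n+2,k) = G(n,k+1) − G(n,k).
-- Summing over k gives a second-order recurrence for u with explicit boundary terms.  The closed
-- form satisfies the same recurrence and holds for n = 0 and n = 1, hence for all n.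
--
-- Each step is a polynomial identity with integer coefficients once its hypotheses are multiplied
-- by suitable polynomials, and such identities are decided by normalising integer polynomials.

module Submission where

open import Defs
open import Data.Nat using (ℕ; _≤_)
open import Data.Rational using (ℚ; _÷_; NonZero)
open import Data.Rational as ℚ using (1ℚ)
import Data.Rational.Properties as ℚ
open import Relation.Binary.PropositionalEquality using (_≡_)

open import Level using (Level)
open import Algebra.Bundles using (CommutativeRing)
import Algebra.Solver.Ring
open import Algebra.Solver.Ring.AlmostCommutativeRing
  using (_-Raw-AlmostCommutative⟶_; fromCommutativeRing)
open import Data.Bool using (Bool; true; false; _∧_)
open import Data.Fin using (Fin; zero; suc; #_)
open import Data.Integer as ℤ using (ℤ; +_)
import Data.Integer.Properties as ℤ
open import Data.List using (List; []; _∷_; foldr; map; applyUpTo)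
open import Data.List.Relation.Unary.All using (All; []; _∷_)
open import Data.Maybe using (Maybe; just; nothing)
open import Data.Nat as ℕ using (zero; suc; _∸_; _<_; s≤s; _!)
import Data.Nat.Properties as ℕ
open import Data.Product using (_×_; _,_)
open import Data.Vec using (Vec; []; _∷_; lookup)
open import Function using (_∘_)
import Relation.Binary.PropositionalEquality as ≡
open import Relation.Nullary using (yes; no)

-- The library's ring solvers compare normal forms up to definitional equality in the carrier;
-- here an identity is decided by a closed computation on integer polynomials, which stays fast
-- for the large identities below.
module IntegerPolynomials where

  Poly : ℕ → Set
  Poly zero    = ℤ
  Poly (suc n) = List (Poly n)

  0ₚ : ∀ {n} → Poly n
  0ₚ {zero}  = + 0
  0ₚ {suc n} = []

  constₚ : ∀ {n} → ℤ → Poly n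
  constₚ {zero}  c = c
  constₚ {suc n} c = constₚ c ∷ []

  infixl 6 _+ₚ_
  infixl 7 _*ₚ_ _*ₚ′_

  _+ₚ_ : ∀ {n} → Poly n → Poly n → Poly n
  _+ₚ_ {zero}  a       b       = a ℤ.+ b
  _+ₚ_ {suc n} []      q       = q
  _+ₚ_ {suc n} (a ∷ p) []      = a ∷ p
  _+ₚ_ {suc n} (a ∷ p) (b ∷ q) = a +ₚ b ∷ p +ₚ q

  -ₚ_ : ∀ {n} → Poly n → Poly n
  -ₚ_ {zero}  a       = ℤ.- a
  -ₚ_ {suc n} []      = []
  -ₚ_ {suc n} (a ∷ p) = -ₚ a ∷ -ₚ p

  timesX : ∀ {n} → Poly (suc n) → Poly (suc n)
  timesX []      = []
  timesX (a ∷ p) = 0ₚ ∷ a ∷ p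

  _*ₚ_  : ∀ {n} → Poly n → Poly n → Poly n
  _*ₚ′_ : ∀ {n} → Poly n → Poly (suc n) → Poly (suc n)
  _*ₚ_ {zero}  a       b = a ℤ.* b
  _*ₚ_ {suc n} []      q = []
  _*ₚ_ {suc n} (a ∷ p) q = a *ₚ′ q +ₚ timesX (p *ₚ q)
  a *ₚ′ []      = []
  a *ₚ′ (b ∷ q) = a *ₚ b ∷ a *ₚ′ q

  isZero : ∀ {n} → Poly n → Bool
  isZero {zero}  (+ zero) = true
  isZero {zero}  _        = false
  isZero {suc n} []       = true
  isZero {suc n} (a ∷ p)  = isZero a ∧ isZero p

  infixl 6 _⊕_ _⊖_
  infixl 7 _⊗_

  data Expr (n : ℕ) : Set where
    var         : Fin n → Expr n
    con         : ℤ → Expr n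
    _⊕_ _⊗_ _⊖_ : Expr n → Expr n → Expr n

  varₚ : ∀ {n} → Fin n → Poly n
  varₚ {suc n} zero    = 0ₚ ∷ constₚ (+ 1) ∷ []
  varₚ {suc n} (suc i) = varₚ i ∷ []

  normalise : ∀ {n} → Expr n → Poly n
  normalise (var i) = varₚ i
  normalise (con c) = constₚ c
  normalise (e ⊕ f) = normalise e +ₚ normalise f
  normalise (e ⊗ f) = normalise e *ₚ normalise f
  normalise (e ⊖ f) = normalise e +ₚ -ₚ normalise f

  Hypothesis : ℕ → Set
  Hypothesis n = Expr n × Expr n × Expr n

  combination : ∀ {n} → List (Hypothesis n) → Expr n
  combination []                = con (+ 0)
  combination ((μ , a , b) ∷ hs) = μ ⊗ (a ⊖ b) ⊕ combination hs

  record Certificate (n : ℕ) : Set where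
    field
      lhs rhs multiplier : Expr n
      hypotheses         : List (Hypothesis n)

  -- (lhs − rhs) · multiplier = Σ μ (a − b) as polynomials, so lhs = rhs wherever every
  -- hypothesis a = b holds and the multiplier can be cancelled.
  Valid : ∀ {n} → Certificate n → Set
  Valid C = isZero (normalise ((lhs ⊖ rhs) ⊗ multiplier ⊖ combination hypotheses)) ≡ true
    where open Certificate C

  Univariate : Set
  Univariate = ∀ {n} → Expr n → Expr n

  Bivariate : Set
  Bivariate = ∀ {n} → Expr n → Expr n → Expr n

  one : ∀ {n} → Expr n
  one = con (+ 1)

  -- a + b x: with the constant first, the value a + b * m at a natural m reduces to suc _ when
  -- a > 0, which makes the multipliers of certificates visibly cancellable.
  linear : ℕ → ℕ → Univariate
  linear a b x = con (+ a) ⊕ con (+ b) ⊗ x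

  horner : List ℕ → Univariate
  horner []       x = con (+ 0)
  horner (c ∷ cs) x = con (+ c) ⊕ x ⊗ horner cs x

  horner₂ : List (List ℕ) → Bivariate
  horner₂ []       x y = con (+ 0)
  horner₂ (r ∷ rs) x y = horner r y ⊕ x ⊗ horner₂ rs x y

open IntegerPolynomials

module Evaluation {c ℓ : Level} (R : CommutativeRing c ℓ)
  (ι-morphism : ℤ.+-*-rawRing -Raw-AlmostCommutative⟶ fromCommutativeRing R) where

  open CommutativeRing R hiding (zero)
  open _-Raw-AlmostCommutative⟶_ ι-morphism renaming (⟦_⟧ to ι)
  open import Relation.Binary.Reasoning.Setoid setoid
  open import Algebra.Properties.Ring ring using (-0#≈0#)

  private
    _≟ι_ : (a b : ℤ) → Maybe (ι a ≈ ι b)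
    a ≟ι b with a ℤ.≟ b
    ... | yes ≡.refl = just refl
    ... | no _       = nothing

  module RingSolver = Algebra.Solver.Ring ℤ.+-*-rawRing (fromCommutativeRing R) ι-morphism _≟ι_
  open RingSolver using (solve; _:=_; _:+_; _:*_; _:-_; :-_)

  ⟦_⟧ₚ : ∀ {n} → Poly n → Vec Carrier n → Carrier
  ⟦_⟧ₚ {zero}  c       []      = ι c
  ⟦_⟧ₚ {suc n} []      (x ∷ ρ) = 0#
  ⟦_⟧ₚ {suc n} (a ∷ p) (x ∷ ρ) = ⟦ a ⟧ₚ ρ + x * ⟦ p ⟧ₚ (x ∷ ρ)

  ⟦_⟧ : ∀ {n} → Expr n → Vec Carrier n → Carrier
  ⟦ var i ⟧ ρ = lookup ρ i
  ⟦ con c ⟧ ρ = ι c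
  ⟦ e ⊕ f ⟧ ρ = ⟦ e ⟧ ρ + ⟦ f ⟧ ρ
  ⟦ e ⊗ f ⟧ ρ = ⟦ e ⟧ ρ * ⟦ f ⟧ ρ
  ⟦ e ⊖ f ⟧ ρ = ⟦ e ⟧ ρ - ⟦ f ⟧ ρ

  0ₚ-sound : ∀ {n} (ρ : Vec Carrier n) → ⟦ 0ₚ {n} ⟧ₚ ρ ≈ 0#
  0ₚ-sound {zero}  []      = 0-homo
  0ₚ-sound {suc n} (x ∷ ρ) = refl

  constₚ-sound : ∀ {n} c (ρ : Vec Carrier n) → ⟦ constₚ {n} c ⟧ₚ ρ ≈ ι c
  constₚ-sound {zero}  c []      = refl
  constₚ-sound {suc n} c (x ∷ ρ) = begin
    ⟦ constₚ c ⟧ₚ ρ + x * 0#  ≈⟨ +-cong (constₚ-sound c ρ) (zeroʳ x) ⟩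
    ι c + 0#                  ≈⟨ +-identityʳ (ι c) ⟩
    ι c                       ∎

  +ₚ-sound : ∀ {n} (p q : Poly n) ρ → ⟦ p +ₚ q ⟧ₚ ρ ≈ ⟦ p ⟧ₚ ρ + ⟦ q ⟧ₚ ρ
  +ₚ-sound {zero}  a       b       []      = +-homo a b
  +ₚ-sound {suc n} []      q       (x ∷ ρ) = sym (+-identityˡ _)
  +ₚ-sound {suc n} (a ∷ p) []      (x ∷ ρ) = sym (+-identityʳ _)
  +ₚ-sound {suc n} (a ∷ p) (b ∷ q) (x ∷ ρ) = begin
    ⟦ a +ₚ b ⟧ₚ ρ + x * ⟦ p +ₚ q ⟧ₚ (x ∷ ρ)
      ≈⟨ +-cong (+ₚ-sound a b ρ) (*-congˡ (+ₚ-sound p q (x ∷ ρ))) ⟩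
    (A + B) + x * (P + Q)
      ≈⟨ solve 5 (λ A B X P Q → (A :+ B) :+ X :* (P :+ Q) := (A :+ X :* P) :+ (B :+ X :* Q))
           refl A B x P Q ⟩
    (A + x * P) + (B + x * Q) ∎
    where
    A B P Q : Carrier
    A = ⟦ a ⟧ₚ ρ
    B = ⟦ b ⟧ₚ ρ
    P = ⟦ p ⟧ₚ (x ∷ ρ)
    Q = ⟦ q ⟧ₚ (x ∷ ρ)

  -ₚ-sound : ∀ {n} (p : Poly n) ρ → ⟦ -ₚ p ⟧ₚ ρ ≈ - ⟦ p ⟧ₚ ρ
  -ₚ-sound {zero}  a       []      = -‿homo a
  -ₚ-sound {suc n} []      (x ∷ ρ) = sym -0#≈0#
  -ₚ-sound {suc n} (a ∷ p) (x ∷ ρ) = begin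
    ⟦ -ₚ a ⟧ₚ ρ + x * ⟦ -ₚ p ⟧ₚ (x ∷ ρ)
      ≈⟨ +-cong (-ₚ-sound a ρ) (*-congˡ (-ₚ-sound p (x ∷ ρ))) ⟩
    - A + x * - P
      ≈⟨ solve 3 (λ A X P → :- A :+ X :* :- P := :- (A :+ X :* P)) refl A x P ⟩
    - (A + x * P) ∎
    where
    A P : Carrier
    A = ⟦ a ⟧ₚ ρ
    P = ⟦ p ⟧ₚ (x ∷ ρ)

  timesX-sound : ∀ {n} (p : Poly (suc n)) x ρ → ⟦ timesX p ⟧ₚ (x ∷ ρ) ≈ x * ⟦ p ⟧ₚ (x ∷ ρ)
  timesX-sound []      x ρ = sym (zeroʳ x)
  timesX-sound (a ∷ p) x ρ = begin
    ⟦ 0ₚ ⟧ₚ ρ + x * ⟦ a ∷ p ⟧ₚ (x ∷ ρ)  ≈⟨ +-congʳ (0ₚ-sound ρ) ⟩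
    0# + x * ⟦ a ∷ p ⟧ₚ (x ∷ ρ)         ≈⟨ +-identityˡ _ ⟩
    x * ⟦ a ∷ p ⟧ₚ (x ∷ ρ)              ∎

  *ₚ-sound  : ∀ {n} (p q : Poly n) ρ → ⟦ p *ₚ q ⟧ₚ ρ ≈ ⟦ p ⟧ₚ ρ * ⟦ q ⟧ₚ ρ
  *ₚ′-sound : ∀ {n} (a : Poly n) (q : Poly (suc n)) x ρ →
              ⟦ a *ₚ′ q ⟧ₚ (x ∷ ρ) ≈ ⟦ a ⟧ₚ ρ * ⟦ q ⟧ₚ (x ∷ ρ)
  *ₚ-sound {zero}  a       b []      = *-homo a b
  *ₚ-sound {suc n} []      q (x ∷ ρ) = sym (zeroˡ _)
  *ₚ-sound {suc n} (a ∷ p) q (x ∷ ρ) = begin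
    ⟦ a *ₚ′ q +ₚ timesX (p *ₚ q) ⟧ₚ (x ∷ ρ)
      ≈⟨ +ₚ-sound (a *ₚ′ q) _ (x ∷ ρ) ⟩
    ⟦ a *ₚ′ q ⟧ₚ (x ∷ ρ) + ⟦ timesX (p *ₚ q) ⟧ₚ (x ∷ ρ)
      ≈⟨ +-cong (*ₚ′-sound a q x ρ)
                (trans (timesX-sound (p *ₚ q) x ρ) (*-congˡ (*ₚ-sound p q (x ∷ ρ)))) ⟩
    A * Q + x * (P * Q)
      ≈⟨ solve 4 (λ A Q X P → A :* Q :+ X :* (P :* Q) := (A :+ X :* P) :* Q) refl A Q x P ⟩
    (A + x * P) * Q ∎
    where
    A P Q : Carrier
    A = ⟦ a ⟧ₚ ρ
    P = ⟦ p ⟧ₚ (x ∷ ρ)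
    Q = ⟦ q ⟧ₚ (x ∷ ρ)
  *ₚ′-sound a []      x ρ = sym (zeroʳ _)
  *ₚ′-sound a (b ∷ q) x ρ = begin
    ⟦ a *ₚ b ⟧ₚ ρ + x * ⟦ a *ₚ′ q ⟧ₚ (x ∷ ρ)
      ≈⟨ +-cong (*ₚ-sound a b ρ) (*-congˡ (*ₚ′-sound a q x ρ)) ⟩
    A * B + x * (A * Q)
      ≈⟨ solve 4 (λ A B X Q → A :* B :+ X :* (A :* Q) := A :* (B :+ X :* Q)) refl A B x Q ⟩
    A * (B + x * Q) ∎
    where
    A B Q : Carrier
    A = ⟦ a ⟧ₚ ρ
    B = ⟦ b ⟧ₚ ρ
    Q = ⟦ q ⟧ₚ (x ∷ ρ)

  isZero-sound : ∀ {n} (p : Poly n) ρ → isZero p ≡ true → ⟦ p ⟧ₚ ρ ≈ 0#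
  isZero-sound {zero}  (+ zero) [] _ = 0-homo
  isZero-sound {suc n} []       (x ∷ ρ) _ = refl
  isZero-sound {suc n} (a ∷ p)  (x ∷ ρ) eq with isZero a in a≡0 | isZero p in p≡0
  ... | true | true = begin
    ⟦ a ⟧ₚ ρ + x * ⟦ p ⟧ₚ (x ∷ ρ)
      ≈⟨ +-cong (isZero-sound a ρ a≡0) (*-congˡ (isZero-sound p (x ∷ ρ) p≡0)) ⟩
    0# + x * 0#  ≈⟨ +-identityˡ _ ⟩
    x * 0#       ≈⟨ zeroʳ x ⟩
    0#           ∎

  varₚ-sound : ∀ {n} (i : Fin n) ρ → ⟦ varₚ i ⟧ₚ ρ ≈ lookup ρ i
  varₚ-sound {suc n} zero (x ∷ ρ) = begin
    ⟦ 0ₚ ⟧ₚ ρ + x * (⟦ constₚ (+ 1) ⟧ₚ ρ + x * 0#)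
      ≈⟨ +-cong (0ₚ-sound ρ) (*-congˡ (+-congʳ (trans (constₚ-sound (+ 1) ρ) 1-homo))) ⟩
    0# + x * (1# + x * 0#)  ≈⟨ +-identityˡ _ ⟩
    x * (1# + x * 0#)       ≈⟨ *-congˡ (trans (+-congˡ (zeroʳ x)) (+-identityʳ 1#)) ⟩
    x * 1#                  ≈⟨ *-identityʳ x ⟩
    x                       ∎
  varₚ-sound {suc n} (suc i) (x ∷ ρ) = begin
    ⟦ varₚ i ⟧ₚ ρ + x * 0#  ≈⟨ +-cong (varₚ-sound i ρ) (zeroʳ x) ⟩
    lookup ρ i + 0#        ≈⟨ +-identityʳ _ ⟩
    lookup ρ i             ∎

  normalise-sound : ∀ {n} (e : Expr n) ρ → ⟦ normalise e ⟧ₚ ρ ≈ ⟦ e ⟧ ρ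
  normalise-sound (var i) ρ = varₚ-sound i ρ
  normalise-sound (con c) ρ = constₚ-sound c ρ
  normalise-sound (e ⊕ f) ρ =
    trans (+ₚ-sound (normalise e) _ ρ) (+-cong (normalise-sound e ρ) (normalise-sound f ρ))
  normalise-sound (e ⊗ f) ρ =
    trans (*ₚ-sound (normalise e) _ ρ) (*-cong (normalise-sound e ρ) (normalise-sound f ρ))
  normalise-sound (e ⊖ f) ρ =
    trans (+ₚ-sound (normalise e) _ ρ)
          (+-cong (normalise-sound e ρ) (trans (-ₚ-sound (normalise f) ρ) (-‿cong (normalise-sound f ρ))))

  prove : ∀ {n} (e f : Expr n) → isZero (normalise (e ⊖ f)) ≡ true →
          ∀ ρ → ⟦ e ⟧ ρ ≈ ⟦ f ⟧ ρ
  prove e f e-f≡0 ρ = begin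
    ⟦ e ⟧ ρ
      ≈⟨ solve 2 (λ E F → E := (E :- F) :+ F) refl (⟦ e ⟧ ρ) (⟦ f ⟧ ρ) ⟩
    (⟦ e ⟧ ρ - ⟦ f ⟧ ρ) + ⟦ f ⟧ ρ
      ≈⟨ +-congʳ (trans (sym (normalise-sound (e ⊖ f) ρ)) (isZero-sound _ ρ e-f≡0)) ⟩
    0# + ⟦ f ⟧ ρ  ≈⟨ +-identityˡ _ ⟩
    ⟦ f ⟧ ρ       ∎

  ⟦⟧-cong : ∀ {n} (e : Expr n) {ρ σ : Vec Carrier n} →
            (∀ i → lookup ρ i ≈ lookup σ i) → ⟦ e ⟧ ρ ≈ ⟦ e ⟧ σ
  ⟦⟧-cong (var i) ρ≈σ = ρ≈σ i
  ⟦⟧-cong (con c) ρ≈σ = refl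
  ⟦⟧-cong (e ⊕ f) ρ≈σ = +-cong (⟦⟧-cong e ρ≈σ) (⟦⟧-cong f ρ≈σ)
  ⟦⟧-cong (e ⊗ f) ρ≈σ = *-cong (⟦⟧-cong e ρ≈σ) (⟦⟧-cong f ρ≈σ)
  ⟦⟧-cong (e ⊖ f) ρ≈σ = +-cong (⟦⟧-cong e ρ≈σ) (-‿cong (⟦⟧-cong f ρ≈σ))

  Holds : ∀ {n} → Vec Carrier n → Hypothesis n → Set ℓ
  Holds ρ (_ , a , b) = ⟦ a ⟧ ρ ≈ ⟦ b ⟧ ρ

  combination-zero : ∀ {n} (ρ : Vec Carrier n) hs → All (Holds ρ) hs → ⟦ combination hs ⟧ ρ ≈ 0#
  combination-zero ρ []                 []           = 0-homo
  combination-zero ρ ((μ , a , b) ∷ hs) (a≈b ∷ hold) = begin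
    ⟦ μ ⟧ ρ * (⟦ a ⟧ ρ - ⟦ b ⟧ ρ) + ⟦ combination hs ⟧ ρ
      ≈⟨ +-cong (*-congˡ (trans (+-congʳ a≈b) (-‿inverseʳ _))) (combination-zero ρ hs hold) ⟩
    ⟦ μ ⟧ ρ * 0# + 0#  ≈⟨ +-identityʳ _ ⟩
    ⟦ μ ⟧ ρ * 0#       ≈⟨ zeroʳ _ ⟩
    0#                 ∎

  certificate-sound : ∀ {n} (C : Certificate n) → Valid C → let open Certificate C in
    ∀ ρ → All (Holds ρ) hypotheses → (⟦ lhs ⟧ ρ - ⟦ rhs ⟧ ρ) * ⟦ multiplier ⟧ ρ ≈ 0#
  certificate-sound C valid ρ hold =
    trans (prove ((lhs ⊖ rhs) ⊗ multiplier) (combination hypotheses) valid ρ)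
          (combination-zero ρ hypotheses hold)
    where open Certificate C

  infix 10 _⟨_⟩ _⟨_∣_⟩

  _⟨_⟩ : Univariate → Carrier → Carrier
  p ⟨ x ⟩ = ⟦ p (var zero) ⟧ (x ∷ [])

  _⟨_∣_⟩ : Bivariate → Carrier → Carrier → Carrier
  p ⟨ x ∣ y ⟩ = ⟦ p (var zero) (var (suc zero)) ⟧ (x ∷ y ∷ [])

  ⟨⟩-cong : ∀ (p : Univariate) {x y} → x ≈ y → p ⟨ x ⟩ ≈ p ⟨ y ⟩
  ⟨⟩-cong p {x} {y} x≈y = ⟦⟧-cong (p (var zero)) x≈y′
    where
    x≈y′ : ∀ i → lookup (x ∷ []) i ≈ lookup (y ∷ []) i
    x≈y′ zero = x≈y

  ⟨∣⟩-cong : ∀ (p : Bivariate) {x x′ y y′} → x ≈ x′ → y ≈ y′ →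
             p ⟨ x ∣ y ⟩ ≈ p ⟨ x′ ∣ y′ ⟩
  ⟨∣⟩-cong p {x} {x′} {y} {y′} x≈x′ y≈y′ = ⟦⟧-cong (p (var zero) (var (suc zero))) xy≈x′y′
    where
    xy≈x′y′ : ∀ i → lookup (x ∷ y ∷ []) i ≈ lookup (x′ ∷ y′ ∷ []) i
    xy≈x′y′ zero       = x≈x′
    xy≈x′y′ (suc zero) = y≈y′

  fromℕ : ℕ → Carrier
  fromℕ m = ι (+ m)

  fromℕ-+ : ∀ a b → fromℕ (a ℕ.+ b) ≈ fromℕ a + fromℕ b
  fromℕ-+ a b = trans (reflexive (≡.cong ι (ℤ.pos-+ a b))) (+-homo (+ a) (+ b))

  fromℕ-* : ∀ a b → fromℕ (a ℕ.* b) ≈ fromℕ a * fromℕ b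
  fromℕ-* a b = trans (reflexive (≡.cong ι (ℤ.pos-* a b))) (*-homo (+ a) (+ b))

  fromℕ-1 : fromℕ 1 ≈ 1#
  fromℕ-1 = 1-homo

  fromℕ-suc : ∀ a → fromℕ (suc a) ≈ fromℕ a + fromℕ 1
  fromℕ-suc a = trans (reflexive (≡.cong fromℕ (ℕ.+-comm 1 a))) (fromℕ-+ a 1)

  fromℕ-pred : ∀ a → fromℕ (suc a) - fromℕ 1 ≈ fromℕ a
  fromℕ-pred a = trans (+-congʳ (fromℕ-suc a))
    (solve 2 (λ a b → a :+ b :- b := a) refl (fromℕ a) (fromℕ 1))

  +-fromℕ : ∀ {x y a b} → x ≈ fromℕ a → y ≈ fromℕ b → x + y ≈ fromℕ (a ℕ.+ b)
  +-fromℕ {a = a} {b} x≈a y≈b = trans (+-cong x≈a y≈b) (sym (fromℕ-+ a b))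

  *-fromℕ : ∀ {x y a b} → x ≈ fromℕ a → y ≈ fromℕ b → x * y ≈ fromℕ (a ℕ.* b)
  *-fromℕ {a = a} {b} x≈a y≈b = trans (*-cong x≈a y≈b) (sym (fromℕ-* a b))

  linear-fromℕ : ∀ a b {x m} → x ≈ fromℕ m → linear a b ⟨ x ⟩ ≈ fromℕ (a ℕ.+ b ℕ.* m)
  linear-fromℕ a b x≈m = +-fromℕ refl (*-fromℕ refl x≈m)

module Sums {c ℓ : Level} (R : CommutativeRing c ℓ) where

  open CommutativeRing R hiding (zero)
  open import Relation.Binary.Reasoning.Setoid setoid
  open import Algebra.Solver.Ring.NaturalCoefficients.Default commutativeSemiring
    using (solve; _:=_; _:+_; _:*_; con)

  ∑ : ℕ → (ℕ → Carrier) → Carrier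
  ∑ zero    f = 0#
  ∑ (suc m) f = ∑ m f + f m

  ∑-cong : ∀ m {f g : ℕ → Carrier} → (∀ {k} → k < m → f k ≈ g k) → ∑ m f ≈ ∑ m g
  ∑-cong zero    f≈g = refl
  ∑-cong (suc m) f≈g = +-cong (∑-cong m (f≈g ∘ ℕ.m<n⇒m<1+n)) (f≈g (ℕ.n<1+n m))

  ∑-front : ∀ m f → ∑ (suc m) f ≈ f 0 + ∑ m (f ∘ suc)
  ∑-front zero    f = trans (+-identityˡ (f 0)) (sym (+-identityʳ (f 0)))
  ∑-front (suc m) f = begin
    ∑ (suc m) f + f (suc m)              ≈⟨ +-congʳ (∑-front m f) ⟩
    f 0 + ∑ m (f ∘ suc) + f (suc m)      ≈⟨ +-assoc _ _ _ ⟩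
    f 0 + (∑ m (f ∘ suc) + f (suc m))    ∎

  ∑-telescope : ∀ m (F : ℕ → Carrier) → ∑ m (λ k → F (suc k) - F k) ≈ F m - F 0
  ∑-telescope zero    F = sym (-‿inverseʳ (F 0))
  ∑-telescope (suc m) F = begin
    ∑ m (λ k → F (suc k) - F k) + (F (suc m) - F m)  ≈⟨ +-congʳ (∑-telescope m F) ⟩
    (F m - F 0) + (F (suc m) - F m)                  ≈⟨ +-comm _ _ ⟩
    (F (suc m) - F m) + (F m - F 0)                  ≈⟨ +-assoc _ _ _ ⟩
    F (suc m) + (- F m + (F m - F 0))                ≈⟨ +-congˡ (sym (+-assoc _ _ _)) ⟩
    F (suc m) + ((- F m + F m) - F 0)                ≈⟨ +-congˡ (+-congʳ (-‿inverseˡ (F m))) ⟩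
    F (suc m) + (0# - F 0)                           ≈⟨ +-congˡ (+-identityˡ _) ⟩
    F (suc m) - F 0                                  ∎

  ∑-linear₃ : ∀ m a b c (f g h : ℕ → Carrier) →
    ∑ m (λ k → a * f k + b * g k + c * h k) ≈ a * ∑ m f + b * ∑ m g + c * ∑ m h
  ∑-linear₃ zero    a b c f g h =
    solve 3 (λ a b c → con 0 := a :* con 0 :+ b :* con 0 :+ c :* con 0) refl a b c
  ∑-linear₃ (suc m) a b c f g h = begin
    ∑ m (λ k → a * f k + b * g k + c * h k) + (a * f m + b * g m + c * h m)
      ≈⟨ +-congʳ (∑-linear₃ m a b c f g h) ⟩
    a * ∑ m f + b * ∑ m g + c * ∑ m h + (a * f m + b * g m + c * h m)
      ≈⟨ solve 9 (λ a b c F G H x y z → a :* F :+ b :* G :+ c :* H :+ (a :* x :+ b :* y :+ c :* z)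
                    := a :* (F :+ x) :+ b :* (G :+ y) :+ c :* (H :+ z))
           refl a b c (∑ m f) (∑ m g) (∑ m h) (f m) (g m) (h m) ⟩
    a * ∑ (suc m) f + b * ∑ (suc m) g + c * ∑ (suc m) h ∎

  foldr-applyUpTo : ∀ m (f : ℕ → Carrier) (g : ℕ → ℕ) →
    foldr _+_ 0# (map f (applyUpTo g m)) ≈ ∑ m (f ∘ g)
  foldr-applyUpTo zero    f g = refl
  foldr-applyUpTo (suc m) f g = begin
    f (g 0) + foldr _+_ 0# (map f (applyUpTo (g ∘ suc) m))  ≈⟨ +-congˡ (foldr-applyUpTo m f (g ∘ suc)) ⟩
    f (g 0) + ∑ m (f ∘ g ∘ suc)                            ≈⟨ sym (∑-front m (f ∘ g)) ⟩
    ∑ (suc m) (f ∘ g)                                      ∎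

  square-coeff : (ℕ → Carrier) → ℕ → Carrier
  square-coeff a n = ∑ (suc n) (λ k → a k * a (n ∸ k))

  square-coeff-split : ∀ a m → square-coeff a (suc m) ≈
    a 0 * a (suc m) + ∑ m (λ k → a (suc k) * a (m ∸ k)) + a (suc m) * a 0
  square-coeff-split a m =
    +-cong (∑-front m _) (*-congˡ (reflexive (≡.cong a (ℕ.n∸n≡0 m))))

  square-coeff-unit : ∀ {a b : ℕ → Carrier} → a 0 ≈ 1# → b 0 ≈ 0# →
    (∀ k → a (suc k) ≈ b (suc k)) →
    ∀ m → square-coeff a (suc m) ≈ square-coeff b (suc m) + (a (suc m) + a (suc m))
  square-coeff-unit {a} {b} a₀≈1 b₀≈0 a≈b m = begin
    square-coeff a (suc m)                 ≈⟨ square-coeff-split a m ⟩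
    a 0 * a′ + S a + a′ * a 0              ≈⟨ +-cong (+-cong (*-congʳ a₀≈1) S≈) (*-congˡ a₀≈1) ⟩
    1# * a′ + S b + a′ * 1#                ≈⟨ +-cong (+-congʳ (*-identityˡ a′)) (*-identityʳ a′) ⟩
    a′ + S b + a′
      ≈⟨ solve 2 (λ x s → x :+ s :+ x := s :+ (x :+ x)) refl a′ (S b) ⟩
    S b + (a′ + a′)                        ≈⟨ +-congʳ (sym unit-terms) ⟩
    b 0 * b′ + S b + b′ * b 0 + (a′ + a′)  ≈⟨ +-congʳ (sym (square-coeff-split b m)) ⟩
    square-coeff b (suc m) + (a′ + a′)     ∎
    where
    a′ b′ : Carrier
    a′ = a (suc m)
    b′ = b (suc m)
    S : (ℕ → Carrier) → Carrier
    S x = ∑ m (λ k → x (suc k) * x (m ∸ k))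
    S≈ : S a ≈ S b
    S≈ = ∑-cong m λ {k} k<m → *-cong (a≈b k)
      (begin
        a (m ∸ k)              ≡⟨ ≡.cong a (∸-positive k<m) ⟩
        a (suc (m ∸ suc k))    ≈⟨ a≈b (m ∸ suc k) ⟩
        b (suc (m ∸ suc k))    ≡⟨ ≡.cong b (∸-positive k<m) ⟨
        b (m ∸ k)              ∎)
      where
      ∸-positive : ∀ {m k} → k < m → m ∸ k ≡ suc (m ∸ suc k)
      ∸-positive {suc m} (s≤s k≤m) = ℕ.+-∸-assoc 1 k≤m
    unit-terms : b 0 * b′ + S b + b′ * b 0 ≈ S b
    unit-terms = begin
      b 0 * b′ + S b + b′ * b 0
        ≈⟨ +-cong (+-congʳ (trans (*-congʳ b₀≈0) (zeroˡ b′))) (trans (*-congˡ b₀≈0) (zeroʳ b′)) ⟩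
      0# + S b + 0#              ≈⟨ +-identityʳ _ ⟩
      0# + S b                   ≈⟨ +-identityˡ _ ⟩
      S b                        ∎

stepNum stepDen auxDen : Univariate
stepNum n = linear 5 4 n ⊗ linear 4 4 n ⊗ linear 3 4 n ⊗ linear 2 4 n
stepDen n = linear 2 1 n ⊗ linear 5 3 n ⊗ linear 4 3 n ⊗ linear 3 3 n
auxDen  n = linear 2 1 n ⊗ linear 4 3 n ⊗ linear 5 3 n

-- Zeilberger's recurrence and certificate for the summand tₖ tₙ₋ₖ, in factored form.
A₀ A₁ A₂ : Univariate
A₀ n = con (+ 1024) ⊗ linear 1 1 n ⊗ linear 2 1 n ⊗ linear 3 1 n ⊗ linear 3 2 n
         ⊗ linear 5 2 n ⊗ linear 5 4 n ⊗ linear 7 4 n ⊗ linear 17 6 n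
A₁ n = con (ℤ.- + 24) ⊗ linear 2 1 n ⊗ linear 3 1 n ⊗ linear 5 2 n ⊗ linear 7 3 n
         ⊗ linear 8 3 n ⊗ horner (2003 ∷ 2850 ∷ 1312 ∷ 192 ∷ []) n
A₂ n = con (+ 9) ⊗ linear 2 1 n ⊗ linear 3 1 n ⊗ linear 4 1 n ⊗ linear 7 3 n
         ⊗ linear 8 3 n ⊗ linear 10 3 n ⊗ linear 11 3 n ⊗ linear 11 6 n

Γ : Bivariate
Γ k j = con (+ 24) ⊗ linear 1 1 k ⊗ linear 1 3 k ⊗ linear 2 3 k ⊗ horner₂
  ( (75600 ∷ 517860 ∷ 1456350 ∷ 2189460 ∷ 1907850 ∷ 966840 ∷ 264600 ∷ 30240 ∷ [])
  ∷ (245520 ∷ 1360317 ∷ 3013594 ∷ 3438889 ∷ 2141044 ∷ 691572 ∷ 90720 ∷ [])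
  ∷ (286335 ∷ 1263348 ∷ 2144237 ∷ 1760302 ∷ 701592 ∷ 108864 ∷ [])
  ∷ (169550 ∷ 570035 ∷ 695798 ∷ 367200 ∷ 70848 ∷ [])
  ∷ (53605 ∷ 130394 ∷ 103440 ∷ 26784 ∷ [])
  ∷ (6870 ∷ 10860 ∷ 4320 ∷ [])
  ∷ []) k j

closedNum closedDen : Univariate
closedNum n = con (+ 10) ⊗ (n ⊖ one) ⊗ (n ⊗ n ⊕ linear 12 14 n) ⊕ con (+ 2) ⊗ closedDen n
closedDen n = con (+ 3) ⊗ linear 5 3 n ⊗ linear 4 3 n ⊗ linear 2 1 n

module NaturalValues where

  open import Data.Nat using (_+_; _*_)

  stepNumℕ stepDenℕ auxDenℕ closedDenℕ A₂ℕ : ℕ → ℕ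
  stepNumℕ   m = (5 + 4 * m) * (4 + 4 * m) * (3 + 4 * m) * (2 + 4 * m)
  stepDenℕ   m = (2 + 1 * m) * (5 + 3 * m) * (4 + 3 * m) * (3 + 3 * m)
  auxDenℕ    m = (2 + 1 * m) * (4 + 3 * m) * (5 + 3 * m)
  closedDenℕ m = 3 * (5 + 3 * m) * (4 + 3 * m) * (2 + 1 * m)
  A₂ℕ        m = 9 * (2 + 1 * m) * (3 + 1 * m) * (4 + 1 * m) * (7 + 3 * m)
                   * (8 + 3 * m) * (10 + 3 * m) * (11 + 3 * m) * (11 + 6 * m)

open NaturalValues

zeilberger-certificate : Certificate 9
zeilberger-certificate = record
  { lhs        = A₀ n ⊗ (t[k] ⊗ t[j]) ⊕ A₁ n ⊗ (t[k] ⊗ t[j+1]) ⊕ A₂ n ⊗ (t[k] ⊗ t[j+2])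
  ; rhs        = Γ (k ⊕ one) j ⊗ t[k+1] ⊗ e[j] ⊖ Γ k (j ⊕ one) ⊗ t[k] ⊗ e[j+1]
  ; multiplier = stepDen j ⊗ stepDen (j ⊕ one) ⊗ stepDen k
  ; hypotheses =
      ( t[k] ⊗ stepDen k ⊗ (A₁ n ⊗ stepDen (j ⊕ one) ⊕ A₂ n ⊗ stepNum (j ⊕ one)
                              ⊕ con (+ 3) ⊗ (j ⊕ con (+ 2)) ⊗ Γ k (j ⊕ one))
      , t[j+1] ⊗ stepDen j , t[j] ⊗ stepNum j )
    ∷ ( A₂ n ⊗ t[k] ⊗ stepDen k ⊗ stepDen j
      , t[j+2] ⊗ stepDen (j ⊕ one) , t[j+1] ⊗ stepNum (j ⊕ one) )
    ∷ ( con (+ 3) ⊗ (j ⊕ one) ⊗ Γ (k ⊕ one) j ⊗ stepDen (j ⊕ one) ⊗ t[j]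
      , t[k] ⊗ stepNum k , t[k+1] ⊗ stepDen k )
    ∷ ( con (+ 3) ⊗ (j ⊕ one) ⊗ Γ (k ⊕ one) j ⊗ stepDen (j ⊕ one) ⊗ t[k+1] ⊗ stepDen k
      , t[j] , e[j] ⊗ auxDen j )
    ∷ ( con (+ 3) ⊗ (j ⊕ con (+ 2)) ⊗ Γ k (j ⊕ one) ⊗ stepDen k ⊗ t[k] ⊗ stepDen j
      , e[j+1] ⊗ auxDen (j ⊕ one) , t[j+1] )
    ∷ []
  }
  where
  k j t[k] t[j] t[j+1] t[j+2] t[k+1] e[j] e[j+1] n : Expr 9
  k      = var (# 0)
  j      = var (# 1)
  t[k]   = var (# 2)
  t[j]   = var (# 3)
  t[j+1] = var (# 4)
  t[j+2] = var (# 5)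
  t[k+1] = var (# 6)
  e[j]   = var (# 7)
  e[j+1] = var (# 8)
  n      = k ⊕ j

zeilberger-certificate-valid : Valid zeilberger-certificate
zeilberger-certificate-valid = ≡.refl

-- The multipliers eliminate u(n+2) by the recurrence, u(n) and u(n+1) by the closed form, and
-- t(n), t(n+2), e(0), e(n+1), t(0), t(1) in favour of t(n+1); a polynomial identity in n remains.
step-certificate : Certificate 11
step-certificate = record
  { lhs        = c₂ ⊗ u[n+2]
  ; rhs        = closedNum n+2 ⊗ t[n+2]
  ; multiplier = K ⊗ c₀ ⊗ c₁ ⊗ A₂ n
  ; hypotheses =
      ( K ⊗ c₀ ⊗ c₁ ⊗ c₂
      , A₀ n ⊗ u[n] ⊕ A₁ n ⊗ u[n+1] ⊕ A₂ n ⊗ u[n+2]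
      , Γ n+1 0̂ ⊗ t[n+1] ⊗ e[0] ⊖ Γ 0̂ n+1 ⊗ t[0] ⊗ e[n+1]
          ⊕ A₁ n ⊗ (t[n+1] ⊗ t[0]) ⊕ A₂ n ⊗ (t[n+1] ⊗ t[1] ⊕ t[n+2] ⊗ t[0]) )
    ∷ ( K ⊗ c₁ ⊗ c₂ ⊗ A₀ n , closedNum n ⊗ t[n] , c₀ ⊗ u[n] )
    ∷ ( K ⊗ c₀ ⊗ c₂ ⊗ A₁ n , closedNum n+1 ⊗ t[n+1] , c₁ ⊗ u[n+1] )
    ∷ ( con (+ 120) ⊗ stepDen n+1 ⊗ c₁ ⊗ c₂ ⊗ A₀ n ⊗ closedNum n
      , t[n+1] ⊗ stepDen n , t[n] ⊗ stepNum n )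
    ∷ ( con (+ 120) ⊗ stepNum n ⊗ c₀ ⊗ c₁ ⊗ A₂ n ⊗ (c₂ ⊗ t[0] ⊖ closedNum n+2)
      , t[n+2] ⊗ stepDen n+1 , t[n+1] ⊗ stepNum n+1 )
    ∷ ( con (+ 3) ⊗ c₀ ⊗ c₁ ⊗ c₂ ⊗ stepNum n ⊗ stepDen n+1 ⊗ Γ n+1 0̂ ⊗ t[n+1]
      , e[0] ⊗ auxDen 0̂ , t[0] )
    ∷ ( con (+ 360) ⊗ (n ⊕ con (+ 2)) ⊗ c₀ ⊗ c₁ ⊗ c₂ ⊗ stepNum n ⊗ Γ 0̂ n+1 ⊗ t[0]
      , t[n+1] , e[n+1] ⊗ auxDen n+1 )
    ∷ ( t[n+1] ⊗ c₀ ⊗ c₁ ⊗ c₂ ⊗ (con (+ 3) ⊗ stepNum n ⊗ stepDen n+1 ⊗ Γ n+1 0̂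
          ⊖ con (+ 360) ⊗ (n ⊕ con (+ 2)) ⊗ stepNum n ⊗ Γ 0̂ n+1
          ⊕ K ⊗ A₁ n ⊕ con (+ 120) ⊗ stepNum n ⊗ stepNum n+1 ⊗ A₂ n)
      , t[0] , one )
    ∷ ( t[n+1] ⊗ K ⊗ c₀ ⊗ c₁ ⊗ c₂ ⊗ A₂ n , t[1] , one )
    ∷ []
  }
  where
  n u[n] u[n+1] u[n+2] t[n] t[n+1] t[n+2] e[0] e[n+1] t[0] t[1] : Expr 11
  n       = var (# 0)
  u[n]    = var (# 1)
  u[n+1]  = var (# 2)
  u[n+2]  = var (# 3)
  t[n]    = var (# 4)
  t[n+1]  = var (# 5)
  t[n+2]  = var (# 6)
  e[0]    = var (# 7)
  e[n+1]  = var (# 8)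
  t[0]    = var (# 9)
  t[1]    = var (# 10)
  0̂ n+1 n+2 c₀ c₁ c₂ K : Expr 11
  0̂    = con (+ 0)
  n+1  = n ⊕ one
  n+2  = n+1 ⊕ one
  c₀   = closedDen n
  c₁   = closedDen n+1
  c₂   = closedDen n+2
  K    = con (+ 120) ⊗ stepNum n ⊗ stepDen n+1

step-certificate-valid : Valid step-certificate
step-certificate-valid = ≡.refl

initial-certificate₀ : Certificate 1
initial-certificate₀ = record
  { lhs        = closedDen (con (+ 0)) ⊗ (t[0] ⊗ t[0])
  ; rhs        = closedNum (con (+ 0)) ⊗ t[0]
  ; multiplier = one
  ; hypotheses = (con (+ 120) ⊗ t[0] , t[0] , one) ∷ []
  }
  where
  t[0] : Expr 1
  t[0] = var (# 0)

initial-certificate₁ : Certificate 2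
initial-certificate₁ = record
  { lhs        = closedDen one ⊗ (t[0] ⊗ t[1] ⊕ t[1] ⊗ t[0])
  ; rhs        = closedNum one ⊗ t[1]
  ; multiplier = one
  ; hypotheses = (con (+ 1008) ⊗ t[1] , t[0] , one) ∷ []
  }
  where
  t[0] t[1] : Expr 2
  t[0] = var (# 0)
  t[1] = var (# 1)

initial-certificate₀-valid : Valid initial-certificate₀
initial-certificate₀-valid = ≡.refl

initial-certificate₁-valid : Valid initial-certificate₁
initial-certificate₁-valid = ≡.refl

module ValuesAtNaturals {c ℓ : Level} (R : CommutativeRing c ℓ)
  (ι-morphism : ℤ.+-*-rawRing -Raw-AlmostCommutative⟶ fromCommutativeRing R) where

  open CommutativeRing R hiding (zero)
  open Evaluation R ι-morphism

  module _ {x m} (x≈m : x ≈ fromℕ m) where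

    private
      lin : ∀ a b → linear a b ⟨ x ⟩ ≈ fromℕ (a ℕ.+ b ℕ.* m)
      lin a b = linear-fromℕ a b x≈m

    stepNum-fromℕ : stepNum ⟨ x ⟩ ≈ fromℕ (stepNumℕ m)
    stepNum-fromℕ = *-fromℕ (*-fromℕ (*-fromℕ (lin 5 4) (lin 4 4)) (lin 3 4)) (lin 2 4)

    stepDen-fromℕ : stepDen ⟨ x ⟩ ≈ fromℕ (stepDenℕ m)
    stepDen-fromℕ = *-fromℕ (*-fromℕ (*-fromℕ (lin 2 1) (lin 5 3)) (lin 4 3)) (lin 3 3)

    auxDen-fromℕ : auxDen ⟨ x ⟩ ≈ fromℕ (auxDenℕ m)
    auxDen-fromℕ = *-fromℕ (*-fromℕ (lin 2 1) (lin 4 3)) (lin 5 3)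

    closedDen-fromℕ : closedDen ⟨ x ⟩ ≈ fromℕ (closedDenℕ m)
    closedDen-fromℕ = *-fromℕ (*-fromℕ (*-fromℕ refl (lin 5 3)) (lin 4 3)) (lin 2 1)

    A₂-fromℕ : A₂ ⟨ x ⟩ ≈ fromℕ (A₂ℕ m)
    A₂-fromℕ = *-fromℕ (*-fromℕ (*-fromℕ (*-fromℕ (*-fromℕ (*-fromℕ (*-fromℕ (*-fromℕ refl
      (lin 2 1)) (lin 3 1)) (lin 4 1)) (lin 7 3)) (lin 8 3)) (lin 10 3)) (lin 11 3)) (lin 11 6)

  closedNum-minus-twice-closedDen : ∀ m →
    closedNum ⟨ fromℕ (suc m) ⟩ - (closedDen ⟨ fromℕ (suc m) ⟩ + closedDen ⟨ fromℕ (suc m) ⟩)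
    ≈ fromℕ (10 ℕ.* m ℕ.* (suc m ℕ.* suc m ℕ.+ 14 ℕ.* suc m ℕ.+ 12))
  closedNum-minus-twice-closedDen m = trans
    (prove (closedNum x ⊖ (closedDen x ⊕ closedDen x))
           (con (+ 10) ⊗ (x ⊖ one) ⊗ (x ⊗ x ⊕ con (+ 14) ⊗ x ⊕ con (+ 12)))
           ≡.refl (fromℕ (suc m) ∷ []))
    (*-fromℕ (*-fromℕ refl (fromℕ-pred m))
             (+-fromℕ (+-fromℕ (*-fromℕ refl refl) (*-fromℕ refl refl)) refl))
    where
    x : Expr 1
    x = var zero

module CreativeTelescoping {c ℓ : Level} (R : CommutativeRing c ℓ)
  (ι-morphism : ℤ.+-*-rawRing -Raw-AlmostCommutative⟶ fromCommutativeRing R) where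

  open CommutativeRing R hiding (zero)
  open Evaluation R ι-morphism
  open ValuesAtNaturals R ι-morphism
  open Sums R
  open import Relation.Binary.Reasoning.Setoid setoid
  open import Algebra.Properties.Group +-group using (x∙y⁻¹≈ε⇒x≈y)

  module WithTerm
    (*-cancelʳ-fromℕ : ∀ m {x y} → x * fromℕ (suc m) ≈ y * fromℕ (suc m) → x ≈ y)
    (t e : ℕ → Carrier)
    (t₀ : t 0 ≈ 1#)
    (t-step : ∀ n → t (suc n) * stepDen ⟨ fromℕ n ⟩ ≈ t n * stepNum ⟨ fromℕ n ⟩)
    (e-step : ∀ n → e n * auxDen ⟨ fromℕ n ⟩ ≈ t n)
    where

    from-certificate : ∀ {n} (C : Certificate n) → Valid C → let open Certificate C in
      ∀ ρ → All (Holds ρ) hypotheses →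
      ∀ {k} → ⟦ multiplier ⟧ ρ ≈ fromℕ (suc k) → ⟦ lhs ⟧ ρ ≈ ⟦ rhs ⟧ ρ
    from-certificate C valid ρ hold {k} m≈k = x∙y⁻¹≈ε⇒x≈y _ _
      (*-cancelʳ-fromℕ k (begin
        (⟦ lhs ⟧ ρ - ⟦ rhs ⟧ ρ) * fromℕ (suc k)  ≈⟨ *-congˡ m≈k ⟨
        (⟦ lhs ⟧ ρ - ⟦ rhs ⟧ ρ) * ⟦ multiplier ⟧ ρ ≈⟨ certificate-sound C valid ρ hold ⟩
        0#                                      ≈⟨ zeroˡ _ ⟨
        0# * fromℕ (suc k)                      ∎))
      where open Certificate C

    t₁ : t 1 ≈ 1#
    t₁ = *-cancelʳ-fromℕ 119 (begin
      t 1 * fromℕ 120            ≈⟨ *-congˡ (stepDen-fromℕ refl) ⟨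
      t 1 * stepDen ⟨ fromℕ 0 ⟩  ≈⟨ t-step 0 ⟩
      t 0 * stepNum ⟨ fromℕ 0 ⟩  ≈⟨ *-cong t₀ (stepNum-fromℕ refl) ⟩
      1# * fromℕ 120             ∎)

    u : ℕ → Carrier
    u = square-coeff t

    G : ℕ → ℕ → Carrier
    G n k = Γ ⟨ fromℕ k ∣ fromℕ (suc n ∸ k) ⟩ * t k * e (suc n ∸ k)

    t-step′ : ∀ n → t (suc (suc n)) * stepDen ⟨ fromℕ n + fromℕ 1 ⟩
                    ≈ t (suc n) * stepNum ⟨ fromℕ n + fromℕ 1 ⟩
    t-step′ n = begin
      t (suc (suc n)) * stepDen ⟨ fromℕ n + fromℕ 1 ⟩
        ≈⟨ *-congˡ (⟨⟩-cong stepDen (fromℕ-suc n)) ⟨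
      t (suc (suc n)) * stepDen ⟨ fromℕ (suc n) ⟩  ≈⟨ t-step (suc n) ⟩
      t (suc n) * stepNum ⟨ fromℕ (suc n) ⟩        ≈⟨ *-congˡ (⟨⟩-cong stepNum (fromℕ-suc n)) ⟩
      t (suc n) * stepNum ⟨ fromℕ n + fromℕ 1 ⟩    ∎

    e-step′ : ∀ n → e (suc n) * auxDen ⟨ fromℕ n + fromℕ 1 ⟩ ≈ t (suc n)
    e-step′ n = trans (*-congˡ (⟨⟩-cong auxDen (sym (fromℕ-suc n)))) (e-step (suc n))

    telescoping′ : ∀ k j →
      A₀ ⟨ fromℕ k + fromℕ j ⟩ * (t k * t j) + A₁ ⟨ fromℕ k + fromℕ j ⟩ * (t k * t (suc j))
        + A₂ ⟨ fromℕ k + fromℕ j ⟩ * (t k * t (suc (suc j)))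
      ≈ Γ ⟨ fromℕ k + fromℕ 1 ∣ fromℕ j ⟩ * t (suc k) * e j
        - Γ ⟨ fromℕ k ∣ fromℕ j + fromℕ 1 ⟩ * t k * e (suc j)
    telescoping′ k j = from-certificate zeilberger-certificate zeilberger-certificate-valid
      (fromℕ k ∷ fromℕ j ∷ t k ∷ t j ∷ t (suc j) ∷ t (suc (suc j)) ∷ t (suc k)
         ∷ e j ∷ e (suc j) ∷ [])
      (t-step j ∷ t-step′ j ∷ sym (t-step k) ∷ sym (e-step j) ∷ e-step′ j ∷ [])
      (*-fromℕ (*-fromℕ (stepDen-fromℕ refl) (stepDen-fromℕ (sym (fromℕ-suc j)))) (stepDen-fromℕ refl))

    private
      +-∸-cancel : ∀ i k j → i ℕ.+ (k ℕ.+ j) ∸ k ≡ i ℕ.+ j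
      +-∸-cancel i k j = ≡.trans (ℕ.+-∸-assoc i (ℕ.m≤m+n k j)) (≡.cong (i ℕ.+_) (ℕ.m+n∸m≡n k j))

    summand : ℕ → ℕ → Carrier
    summand n k = t k * t (n ∸ k)

    telescoping : ∀ {n k} → k ≤ n →
      A₀ ⟨ fromℕ n ⟩ * summand n k + A₁ ⟨ fromℕ n ⟩ * summand (suc n) k
        + A₂ ⟨ fromℕ n ⟩ * summand (suc (suc n)) k
      ≈ G n (suc k) - G n k
    telescoping {n} {k} k≤n with n ∸ k | ℕ.m+[n∸m]≡n k≤n
    ... | j | ≡.refl rewrite +-∸-cancel 1 k j | +-∸-cancel 2 k j =
      trans (+-cong (+-cong (*-congʳ (A≈ A₀)) (*-congʳ (A≈ A₁))) (*-congʳ (A≈ A₂)))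
     (trans (telescoping′ k j)
            (+-cong (*-congʳ (*-congʳ (⟨∣⟩-cong Γ (sym (fromℕ-suc k)) refl)))
                    (-‿cong (*-congʳ (*-congʳ (⟨∣⟩-cong Γ refl (sym (fromℕ-suc j))))))))
      where
      A≈ : ∀ (p : Univariate) → p ⟨ fromℕ (k ℕ.+ j) ⟩ ≈ p ⟨ fromℕ k + fromℕ j ⟩
      A≈ p = ⟨⟩-cong p (fromℕ-+ k j)

    telescoped-sum : ∀ n →
      A₀ ⟨ fromℕ n ⟩ * ∑ (suc n) (summand n) + A₁ ⟨ fromℕ n ⟩ * ∑ (suc n) (summand (suc n))
        + A₂ ⟨ fromℕ n ⟩ * ∑ (suc n) (summand (suc (suc n)))
      ≈ G n (suc n) - G n 0
    telescoped-sum n = begin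
      a₀ * ∑ (suc n) (summand n) + a₁ * ∑ (suc n) (summand (suc n))
        + a₂ * ∑ (suc n) (summand (suc (suc n)))
        ≈⟨ ∑-linear₃ (suc n) a₀ a₁ a₂ (summand n) (summand (suc n)) (summand (suc (suc n))) ⟨
      ∑ (suc n) (λ k → a₀ * summand n k + a₁ * summand (suc n) k + a₂ * summand (suc (suc n)) k)
        ≈⟨ ∑-cong (suc n) (λ k<1+n → telescoping (ℕ.≤-pred k<1+n)) ⟩
      ∑ (suc n) (λ k → G n (suc k) - G n k)
        ≈⟨ ∑-telescope (suc n) (G n) ⟩
      G n (suc n) - G n 0 ∎
      where
      a₀ a₁ a₂ : Carrier
      a₀ = A₀ ⟨ fromℕ n ⟩
      a₁ = A₁ ⟨ fromℕ n ⟩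
      a₂ = A₂ ⟨ fromℕ n ⟩

    recurrence : ∀ n →
      A₀ ⟨ fromℕ n ⟩ * u n + A₁ ⟨ fromℕ n ⟩ * u (suc n) + A₂ ⟨ fromℕ n ⟩ * u (suc (suc n))
      ≈ Γ ⟨ fromℕ (suc n) ∣ fromℕ 0 ⟩ * t (suc n) * e 0
        - Γ ⟨ fromℕ 0 ∣ fromℕ (suc n) ⟩ * t 0 * e (suc n)
        + A₁ ⟨ fromℕ n ⟩ * (t (suc n) * t 0)
        + A₂ ⟨ fromℕ n ⟩ * (t (suc n) * t 1 + t (suc (suc n)) * t 0)
    recurrence n = begin
      a₀ * u n + a₁ * u (suc n) + a₂ * u (suc (suc n))
        ≈⟨ +-cong (+-congˡ (*-congˡ (+-congˡ (*-congˡ t[n∸n]≈t₀))))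
                  (*-congˡ (+-cong (+-congˡ (*-congˡ t[1+n∸n]≈t₁)) (*-congˡ t[n∸n]≈t₀))) ⟩
      a₀ * S 0 + a₁ * (S 1 + b₁) + a₂ * (S 2 + b₂ + b₃)
        ≈⟨ solve 9 (λ a₀ a₁ a₂ S₀ S₁ S₂ b₁ b₂ b₃ →
               a₀ :* S₀ :+ a₁ :* (S₁ :+ b₁) :+ a₂ :* (S₂ :+ b₂ :+ b₃)
            := a₀ :* S₀ :+ a₁ :* S₁ :+ a₂ :* S₂ :+ a₁ :* b₁ :+ a₂ :* (b₂ :+ b₃))
            refl a₀ a₁ a₂ (S 0) (S 1) (S 2) b₁ b₂ b₃ ⟩
      a₀ * S 0 + a₁ * S 1 + a₂ * S 2 + a₁ * b₁ + a₂ * (b₂ + b₃)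
        ≈⟨ +-congʳ (+-congʳ (telescoped-sum n)) ⟩
      G n (suc n) - G n 0 + a₁ * b₁ + a₂ * (b₂ + b₃)
        ≈⟨ +-congʳ (+-congʳ (+-congʳ (*-cong (*-congʳ Γ[n∸n]≈γ₁) e[n∸n]≈e₀))) ⟩
      γ₁ * t (suc n) * e 0 - γ₂ * t 0 * e (suc n) + a₁ * b₁ + a₂ * (b₂ + b₃) ∎
      where
      open RingSolver using (solve; _:=_; _:+_; _:*_)
      γ₁ γ₂ a₀ a₁ a₂ b₁ b₂ b₃ : Carrier
      γ₁ = Γ ⟨ fromℕ (suc n) ∣ fromℕ 0 ⟩
      γ₂ = Γ ⟨ fromℕ 0 ∣ fromℕ (suc n) ⟩
      a₀ = A₀ ⟨ fromℕ n ⟩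
      a₁ = A₁ ⟨ fromℕ n ⟩
      a₂ = A₂ ⟨ fromℕ n ⟩
      b₁ = t (suc n) * t 0
      b₂ = t (suc n) * t 1
      b₃ = t (suc (suc n)) * t 0
      S : ℕ → Carrier
      S i = ∑ (suc n) (summand (i ℕ.+ n))
      t[n∸n]≈t₀ : t (n ∸ n) ≈ t 0
      t[n∸n]≈t₀ = reflexive (≡.cong t (ℕ.n∸n≡0 n))
      t[1+n∸n]≈t₁ : t (suc n ∸ n) ≈ t 1
      t[1+n∸n]≈t₁ = reflexive (≡.cong t (ℕ.m+n∸n≡m 1 n))
      e[n∸n]≈e₀ : e (n ∸ n) ≈ e 0
      e[n∸n]≈e₀ = reflexive (≡.cong e (ℕ.n∸n≡0 n))
      Γ[n∸n]≈γ₁ : Γ ⟨ fromℕ (suc n) ∣ fromℕ (n ∸ n) ⟩ ≈ γ₁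
      Γ[n∸n]≈γ₁ = reflexive (≡.cong (λ i → Γ ⟨ fromℕ (suc n) ∣ fromℕ i ⟩) (ℕ.n∸n≡0 n))

    ClosedForm : ℕ → Set ℓ
    ClosedForm n = closedDen ⟨ fromℕ n ⟩ * u n ≈ closedNum ⟨ fromℕ n ⟩ * t n

    closed-form₀ : ClosedForm 0
    closed-form₀ = trans (*-congˡ (+-identityˡ _))
      (from-certificate initial-certificate₀ initial-certificate₀-valid
        (t 0 ∷ []) (trans t₀ (sym fromℕ-1) ∷ []) refl)

    closed-form₁ : ClosedForm 1
    closed-form₁ = trans (*-congˡ (+-congʳ (+-identityˡ _)))
      (from-certificate initial-certificate₁ initial-certificate₁-valid
        (t 0 ∷ t 1 ∷ []) (trans t₀ (sym fromℕ-1) ∷ []) refl)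

    closed-form-step : ∀ n → ClosedForm n → ClosedForm (suc n) → ClosedForm (suc (suc n))
    closed-form-step n Pₙ Pₙ₊₁ = begin
      closedDen ⟨ fromℕ (suc (suc n)) ⟩ * u (suc (suc n))  ≈⟨ *-congʳ (⟨⟩-cong closedDen n+2≈) ⟩
      closedDen ⟨ n̂ + 1̂ + 1̂ ⟩ * u (suc (suc n))
        ≈⟨ from-certificate step-certificate step-certificate-valid ρ hypotheses
             (*-fromℕ (*-fromℕ (*-fromℕ (*-fromℕ (*-fromℕ refl (stepNum-fromℕ refl))
               (stepDen-fromℕ n+1≈)) (closedDen-fromℕ refl)) (closedDen-fromℕ n+1≈)) (A₂-fromℕ refl)) ⟩
      closedNum ⟨ n̂ + 1̂ + 1̂ ⟩ * t (suc (suc n))           ≈⟨ *-congʳ (⟨⟩-cong closedNum n+2≈) ⟨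
      closedNum ⟨ fromℕ (suc (suc n)) ⟩ * t (suc (suc n))  ∎
      where
      n̂ 1̂ : Carrier
      n̂ = fromℕ n
      1̂ = fromℕ 1
      n+1≈ : n̂ + 1̂ ≈ fromℕ (suc n)
      n+1≈ = sym (fromℕ-suc n)
      n+2≈ : fromℕ (suc (suc n)) ≈ n̂ + 1̂ + 1̂
      n+2≈ = trans (fromℕ-suc (suc n)) (+-congʳ (fromℕ-suc n))
      ρ : Vec Carrier 11
      ρ = n̂ ∷ u n ∷ u (suc n) ∷ u (suc (suc n)) ∷ t n ∷ t (suc n) ∷ t (suc (suc n))
            ∷ e 0 ∷ e (suc n) ∷ t 0 ∷ t 1 ∷ []
      recurrenceₙ : A₀ ⟨ n̂ ⟩ * u n + A₁ ⟨ n̂ ⟩ * u (suc n) + A₂ ⟨ n̂ ⟩ * u (suc (suc n))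
        ≈ Γ ⟨ n̂ + 1̂ ∣ fromℕ 0 ⟩ * t (suc n) * e 0 - Γ ⟨ fromℕ 0 ∣ n̂ + 1̂ ⟩ * t 0 * e (suc n)
          + A₁ ⟨ n̂ ⟩ * (t (suc n) * t 0) + A₂ ⟨ n̂ ⟩ * (t (suc n) * t 1 + t (suc (suc n)) * t 0)
      recurrenceₙ = trans (recurrence n) (+-congʳ (+-congʳ (+-cong
        (*-congʳ (*-congʳ (⟨∣⟩-cong Γ (sym n+1≈) refl)))
        (-‿cong (*-congʳ (*-congʳ (⟨∣⟩-cong Γ refl (sym n+1≈))))))))
      Pₙ₊₁′ : closedNum ⟨ n̂ + 1̂ ⟩ * t (suc n) ≈ closedDen ⟨ n̂ + 1̂ ⟩ * u (suc n)
      Pₙ₊₁′ = sym (trans (*-congʳ (⟨⟩-cong closedDen n+1≈))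
                  (trans Pₙ₊₁ (*-congʳ (⟨⟩-cong closedNum (sym n+1≈)))))
      hypotheses : All (Holds ρ) (Certificate.hypotheses step-certificate)
      hypotheses = recurrenceₙ ∷ sym Pₙ ∷ Pₙ₊₁′ ∷ t-step n ∷ t-step′ n ∷ e-step 0 ∷ sym (e-step′ n)
                 ∷ trans t₀ (sym fromℕ-1) ∷ trans t₁ (sym fromℕ-1) ∷ []

    closed-form : ∀ n → ClosedForm n
    closed-form 0             = closed-form₀
    closed-form 1             = closed-form₁
    closed-form (suc (suc n)) = closed-form-step n (closed-form n) (closed-form (suc n))

    closed-form-square : ∀ {b : ℕ → Carrier} → b 0 ≈ 0# → (∀ k → t (suc k) ≈ b (suc k)) →
      ∀ m →
      closedDen ⟨ fromℕ (suc m) ⟩ * square-coeff b (suc m)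
      ≈ (closedNum ⟨ fromℕ (suc m) ⟩ - (closedDen ⟨ fromℕ (suc m) ⟩ + closedDen ⟨ fromℕ (suc m) ⟩))
        * t (suc m)
    closed-form-square {b} b₀ t≈b m = begin
      D * s
        ≈⟨ solve 3 (λ D s τ → D :* s := D :* (s :+ (τ :+ τ)) :- (D :+ D) :* τ) refl D s τ ⟩
      D * (s + (τ + τ)) - (D + D) * τ  ≈⟨ +-congʳ (*-congˡ (square-coeff-unit t₀ b₀ t≈b m)) ⟨
      D * u (suc m) - (D + D) * τ     ≈⟨ +-congʳ (closed-form (suc m)) ⟩
      C * τ - (D + D) * τ
        ≈⟨ solve 3 (λ C D τ → C :* τ :- (D :+ D) :* τ := (C :- (D :+ D)) :* τ) refl C D τ ⟩
      (C - (D + D)) * τ               ∎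
      where
      open RingSolver using (solve; _:=_; _:+_; _:*_; _:-_)
      C D s τ : Carrier
      C = closedNum ⟨ fromℕ (suc m) ⟩
      D = closedDen ⟨ fromℕ (suc m) ⟩
      s = square-coeff b (suc m)
      τ = t (suc m)

module RationalEmbedding where

  open import Data.Rational.Unnormalised as ℚᵘ using (mkℚᵘ; *≡*)
  import Data.Rational.Unnormalised.Properties as ℚᵘ
  open import Data.Integer.Tactic.RingSolver using (solve-∀)

  ι : ℤ → ℚ
  ι z = z ℚ./ 1

  toℚᵘ-ι : ∀ z → ℚ.toℚᵘ (ι z) ℚᵘ.≃ mkℚᵘ z 0
  toℚᵘ-ι z = ℚ.toℚᵘ-fromℚᵘ (mkℚᵘ z 0)

  ι-+ : ∀ a b → ι (a ℤ.+ b) ≡ ι a ℚ.+ ι b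
  ι-+ a b = ℚ.toℚᵘ-injective (begin
    ℚ.toℚᵘ (ι (a ℤ.+ b))            ≈⟨ toℚᵘ-ι (a ℤ.+ b) ⟩
    mkℚᵘ (a ℤ.+ b) 0                ≈⟨ *≡* (lemma a b) ⟩
    mkℚᵘ a 0 ℚᵘ.+ mkℚᵘ b 0          ≈⟨ ℚᵘ.+-cong (toℚᵘ-ι a) (toℚᵘ-ι b) ⟨
    ℚ.toℚᵘ (ι a) ℚᵘ.+ ℚ.toℚᵘ (ι b)  ≈⟨ ℚ.toℚᵘ-homo-+ (ι a) (ι b) ⟨
    ℚ.toℚᵘ (ι a ℚ.+ ι b)            ∎)
    where
    open ℚᵘ.≃-Reasoning
    lemma : ∀ a b → (a ℤ.+ b) ℤ.* + 1 ≡ (a ℤ.* + 1 ℤ.+ b ℤ.* + 1) ℤ.* + 1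
    lemma = solve-∀

  ι-* : ∀ a b → ι (a ℤ.* b) ≡ ι a ℚ.* ι b
  ι-* a b = ℚ.toℚᵘ-injective (begin
    ℚ.toℚᵘ (ι (a ℤ.* b))            ≈⟨ toℚᵘ-ι (a ℤ.* b) ⟩
    mkℚᵘ (a ℤ.* b) 0                ≈⟨ ℚᵘ.*-cong (toℚᵘ-ι a) (toℚᵘ-ι b) ⟨
    ℚ.toℚᵘ (ι a) ℚᵘ.* ℚ.toℚᵘ (ι b)  ≈⟨ ℚ.toℚᵘ-homo-* (ι a) (ι b) ⟨
    ℚ.toℚᵘ (ι a ℚ.* ι b)            ∎)
    where open ℚᵘ.≃-Reasoning

  ι-neg : ∀ a → ι (ℤ.- a) ≡ ℚ.- ι a
  ι-neg a = ℚ.toℚᵘ-injective (begin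
    ℚ.toℚᵘ (ι (ℤ.- a))   ≈⟨ toℚᵘ-ι (ℤ.- a) ⟩
    mkℚᵘ (ℤ.- a) 0       ≈⟨ ℚᵘ.-‿cong (toℚᵘ-ι a) ⟨
    ℚᵘ.- ℚ.toℚᵘ (ι a)    ≈⟨ ℚ.toℚᵘ-homo‿- (ι a) ⟨
    ℚ.toℚᵘ (ℚ.- ι a)     ∎)
    where open ℚᵘ.≃-Reasoning

  ι-morphism : ℤ.+-*-rawRing -Raw-AlmostCommutative⟶ fromCommutativeRing ℚ.+-*-commutativeRing
  ι-morphism = record
    { ⟦_⟧ = ι ; +-homo = ι-+ ; *-homo = ι-* ; -‿homo = ι-neg ; 0-homo = ≡.refl ; 1-homo = ≡.refl }

  /-*-ι : ∀ a b .{{_ : ℕ.NonZero b}} → (a ℚ./ b) ℚ.* ι (+ b) ≡ ι a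
  /-*-ι a (suc b) = ℚ.toℚᵘ-injective (begin
    ℚ.toℚᵘ ((a ℚ./ suc b) ℚ.* ι (+ suc b))
      ≈⟨ ℚ.toℚᵘ-homo-* (a ℚ./ suc b) (ι (+ suc b)) ⟩
    ℚ.toℚᵘ (a ℚ./ suc b) ℚᵘ.* ℚ.toℚᵘ (ι (+ suc b))
      ≈⟨ ℚᵘ.*-cong (ℚ.toℚᵘ-fromℚᵘ (mkℚᵘ a b)) (toℚᵘ-ι (+ suc b)) ⟩
    mkℚᵘ a b ℚᵘ.* mkℚᵘ (+ suc b) 0  ≈⟨ *≡* (lemma a b) ⟩
    mkℚᵘ a 0                        ≈⟨ toℚᵘ-ι a ⟨
    ℚ.toℚᵘ (ι a)                    ∎)
    where
    open ℚᵘ.≃-Reasoning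
    lemma : ∀ a b → (a ℤ.* + suc b) ℤ.* + 1 ≡ a ℤ.* + (suc b ℕ.* 1)
    lemma a b = ≡.trans (ℤ.*-identityʳ _) (≡.cong (λ m → a ℤ.* + m) (≡.sym (ℕ.*-identityʳ (suc b))))

  *-cancelʳ-ι : ∀ m .{{_ : ℕ.NonZero m}} {x y} → x ℚ.* ι (+ m) ≡ y ℚ.* ι (+ m) → x ≡ y
  *-cancelʳ-ι m {x} {y} eq = begin
    x                                  ≡⟨ ℚ.*-identityʳ x ⟨
    x ℚ.* 1ℚ                           ≡⟨ ≡.cong (x ℚ.*_) inverse ⟨
    x ℚ.* (ι (+ m) ℚ.* (+ 1 ℚ./ m))    ≡⟨ ℚ.*-assoc x _ _ ⟨
    x ℚ.* ι (+ m) ℚ.* (+ 1 ℚ./ m)      ≡⟨ ≡.cong (ℚ._* (+ 1 ℚ./ m)) eq ⟩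
    y ℚ.* ι (+ m) ℚ.* (+ 1 ℚ./ m)      ≡⟨ ℚ.*-assoc y _ _ ⟩
    y ℚ.* (ι (+ m) ℚ.* (+ 1 ℚ./ m))    ≡⟨ ≡.cong (y ℚ.*_) inverse ⟩
    y ℚ.* 1ℚ                           ≡⟨ ℚ.*-identityʳ y ⟩
    y                                  ∎
    where
    open ≡.≡-Reasoning
    inverse : ι (+ m) ℚ.* (+ 1 ℚ./ m) ≡ 1ℚ
    inverse = ≡.trans (ℚ.*-comm (ι (+ m)) _) (/-*-ι (+ 1) m)

  ÷-ι : ∀ {s g} .{{_ : NonZero g}} a b .{{_ : ℕ.NonZero b}} →
    ι (+ b) ℚ.* s ≡ ι (+ a) ℚ.* g → s ÷ g ≡ + a ℚ./ b
  ÷-ι {s} {g} a b cross = *-cancelʳ-ι b (begin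
    s ℚ.* g⁻¹ ℚ.* B     ≡⟨ ℚ.*-assoc s g⁻¹ B ⟩
    s ℚ.* (g⁻¹ ℚ.* B)   ≡⟨ ≡.cong (s ℚ.*_) (ℚ.*-comm g⁻¹ B) ⟩
    s ℚ.* (B ℚ.* g⁻¹)   ≡⟨ ℚ.*-assoc s B g⁻¹ ⟨
    s ℚ.* B ℚ.* g⁻¹     ≡⟨ ≡.cong (ℚ._* g⁻¹) (≡.trans (ℚ.*-comm s B) cross) ⟩
    A ℚ.* g ℚ.* g⁻¹     ≡⟨ ℚ.*-assoc A g g⁻¹ ⟩
    A ℚ.* (g ℚ.* g⁻¹)   ≡⟨ ≡.cong (A ℚ.*_) (ℚ.*-inverseʳ g) ⟩
    A ℚ.* 1ℚ            ≡⟨ ℚ.*-identityʳ A ⟩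
    A                   ≡⟨ /-*-ι (+ a) b ⟨
    (+ a ℚ./ b) ℚ.* B   ∎)
    where
    open ≡.≡-Reasoning
    A B g⁻¹ : ℚ
    A   = ι (+ a)
    B   = ι (+ b)
    g⁻¹ = ℚ.1/ g

module HypergeometricTerm where

  open RationalEmbedding
  open Evaluation ℚ.+-*-commutativeRing ι-morphism
  open ValuesAtNaturals ℚ.+-*-commutativeRing ι-morphism
  open import Data.Nat.Tactic.RingSolver using (solve-∀)
  open import Data.Nat using (_+_; _*_)
  open ≡.≡-Reasoning

  numerator denominator : ℕ → ℕ
  numerator   n = 2 * (4 * n + 1) !
  denominator n = (n + 1) ! * (3 * n + 2) !

  denominator-nonZero : ∀ n → ℕ.NonZero (denominator n)
  denominator-nonZero n = (n + 1) ℕ.!* (3 * n + 2) !≢0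

  -- t (suc n) is gCoeff (suc n) by definition, whereas t 0 = 1 and gCoeff 0 = 0.
  t : ℕ → ℚ
  t n = (+ numerator n ℚ./ denominator n) {{denominator-nonZero n}}

  numerator-suc : ∀ n → numerator (suc n) ≡ stepNumℕ n * numerator n
  numerator-suc n = ≡.trans (≡.cong (λ m → 2 * m !) (unfold n)) (lemma n ((4 * n + 1) !))
    where
    unfold : ∀ n → 4 * suc n + 1 ≡ 4 + (4 * n + 1)
    unfold = solve-∀
    lemma : ∀ n a → 2 * ((4 + (4 * n + 1)) * ((3 + (4 * n + 1)) * ((2 + (4 * n + 1))
      * ((1 + (4 * n + 1)) * a))))
      ≡ (5 + 4 * n) * (4 + 4 * n) * (3 + 4 * n) * (2 + 4 * n) * (2 * a)
    lemma = solve-∀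

  denominator-suc : ∀ n → denominator (suc n) ≡ stepDenℕ n * denominator n
  denominator-suc n = ≡.trans (≡.cong (λ m → (suc n + 1) ! * m !) (unfold n))
    (lemma n ((n + 1) !) ((3 * n + 2) !))
    where
    unfold : ∀ n → 3 * suc n + 2 ≡ 3 + (3 * n + 2)
    unfold = solve-∀
    lemma : ∀ n a b → (suc n + 1) * a * ((3 + (3 * n + 2)) * ((2 + (3 * n + 2))
      * ((1 + (3 * n + 2)) * b)))
      ≡ (2 + 1 * n) * (5 + 3 * n) * (4 + 3 * n) * (3 + 3 * n) * (a * b)
    lemma = solve-∀

  t-denominator : ∀ n → t n ℚ.* fromℕ (denominator n) ≡ fromℕ (numerator n)
  t-denominator n = /-*-ι (+ numerator n) (denominator n) {{denominator-nonZero n}}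

  t-step : ∀ n → t (suc n) ℚ.* stepDen ⟨ fromℕ n ⟩ ≡ t n ℚ.* stepNum ⟨ fromℕ n ⟩
  t-step n = *-cancelʳ-ι (denominator n) {{denominator-nonZero n}} (begin
    t (suc n) ℚ.* stepDen ⟨ fromℕ n ⟩ ℚ.* fromℕ (denominator n)
      ≡⟨ ℚ.*-assoc (t (suc n)) _ _ ⟩
    t (suc n) ℚ.* (stepDen ⟨ fromℕ n ⟩ ℚ.* fromℕ (denominator n))
      ≡⟨ ≡.cong (t (suc n) ℚ.*_)
           (*-fromℕ {a = stepDenℕ n} {b = denominator n} (stepDen-fromℕ {m = n} ≡.refl) ≡.refl) ⟩
    t (suc n) ℚ.* fromℕ (stepDenℕ n * denominator n)
      ≡⟨ ≡.cong (λ m → t (suc n) ℚ.* fromℕ m) (denominator-suc n) ⟨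
    t (suc n) ℚ.* fromℕ (denominator (suc n))
      ≡⟨ t-denominator (suc n) ⟩
    fromℕ (numerator (suc n))
      ≡⟨ ≡.cong fromℕ (numerator-suc n) ⟩
    fromℕ (stepNumℕ n * numerator n)
      ≡⟨ *-fromℕ {a = stepNumℕ n} {b = numerator n}
           (stepNum-fromℕ {m = n} ≡.refl) (t-denominator n) ⟨
    stepNum ⟨ fromℕ n ⟩ ℚ.* (t n ℚ.* fromℕ (denominator n))
      ≡⟨ ℚ.*-assoc (stepNum ⟨ fromℕ n ⟩) (t n) _ ⟨
    stepNum ⟨ fromℕ n ⟩ ℚ.* t n ℚ.* fromℕ (denominator n)
      ≡⟨ ≡.cong (ℚ._* fromℕ (denominator n)) (ℚ.*-comm _ (t n)) ⟩
    t n ℚ.* stepNum ⟨ fromℕ n ⟩ ℚ.* fromℕ (denominator n) ∎)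

  t₀ : t 0 ≡ 1ℚ
  t₀ = ≡.refl

  e-denominator-nonZero : ∀ n → ℕ.NonZero (auxDenℕ n * denominator n)
  e-denominator-nonZero n = ℕ.m*n≢0 (auxDenℕ n) (denominator n) {{_}} {{denominator-nonZero n}}

  e : ℕ → ℚ
  e n = (+ numerator n ℚ./ (auxDenℕ n * denominator n)) {{e-denominator-nonZero n}}

  e-step : ∀ n → e n ℚ.* auxDen ⟨ fromℕ n ⟩ ≡ t n
  e-step n = *-cancelʳ-ι (denominator n) {{denominator-nonZero n}} (begin
    e n ℚ.* auxDen ⟨ fromℕ n ⟩ ℚ.* fromℕ (denominator n)
      ≡⟨ ℚ.*-assoc (e n) _ _ ⟩
    e n ℚ.* (auxDen ⟨ fromℕ n ⟩ ℚ.* fromℕ (denominator n))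
      ≡⟨ ≡.cong (e n ℚ.*_)
           (*-fromℕ {a = auxDenℕ n} {b = denominator n} (auxDen-fromℕ {m = n} ≡.refl) ≡.refl) ⟩
    e n ℚ.* fromℕ (auxDenℕ n * denominator n)
      ≡⟨ /-*-ι (+ numerator n) (auxDenℕ n * denominator n) {{e-denominator-nonZero n}} ⟩
    fromℕ (numerator n)
      ≡⟨ t-denominator n ⟨
    t n ℚ.* fromℕ (denominator n) ∎)

  *-cancelʳ-fromℕ-suc : ∀ m {x y} → x ℚ.* fromℕ (suc m) ≡ y ℚ.* fromℕ (suc m) → x ≡ y
  *-cancelʳ-fromℕ-suc m = *-cancelʳ-ι (suc m)

  open CreativeTelescoping ℚ.+-*-commutativeRing ι-morphism
  open WithTerm *-cancelʳ-fromℕ-suc t e t₀ t-step e-step public using (closed-form-square)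

rhs-numerator rhs-denominator : ℕ → ℕ
rhs-numerator   n = 10 ℕ.* (n ∸ 1) ℕ.* (n ℕ.* n ℕ.+ 14 ℕ.* n ℕ.+ 12)
rhs-denominator n = 3 ℕ.* (3 ℕ.* n ℕ.+ 5) ℕ.* (3 ℕ.* n ℕ.+ 4) ℕ.* (n ℕ.+ 2)

module _ where

  open RationalEmbedding using (ι-morphism)
  open Evaluation ℚ.+-*-commutativeRing ι-morphism using (fromℕ; _⟨_⟩)
  open ValuesAtNaturals ℚ.+-*-commutativeRing ι-morphism
  open Sums ℚ.+-*-commutativeRing using (square-coeff; foldr-applyUpTo)
  open HypergeometricTerm using (t; closed-form-square)
  open ≡.≡-Reasoning

  gSqCoeff-square : ∀ n → gSqCoeff n ≡ square-coeff gCoeff n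
  gSqCoeff-square n = foldr-applyUpTo (suc n) (λ k → gCoeff k ℚ.* gCoeff (n ∸ k)) (λ k → k)

  closedDen-rhs-denominator : ∀ n → closedDen ⟨ fromℕ n ⟩ ≡ fromℕ (rhs-denominator n)
  closedDen-rhs-denominator n =
    ≡.trans (closedDen-fromℕ {m = n} ≡.refl) (≡.cong fromℕ (≡.sym (polynomial n)))
    where
    open import Data.Nat.Tactic.RingSolver using (solve-∀)
    polynomial : ∀ n → 3 ℕ.* (3 ℕ.* n ℕ.+ 5) ℕ.* (3 ℕ.* n ℕ.+ 4) ℕ.* (n ℕ.+ 2)
                     ≡ 3 ℕ.* (5 ℕ.+ 3 ℕ.* n) ℕ.* (4 ℕ.+ 3 ℕ.* n) ℕ.* (2 ℕ.+ 1 ℕ.* n)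
    polynomial = solve-∀

  gSqCoeff-cross-multiplied : ∀ m → let n = suc m in
    fromℕ (rhs-denominator n) ℚ.* gSqCoeff n ≡ fromℕ (rhs-numerator n) ℚ.* gCoeff n
  gSqCoeff-cross-multiplied m = begin
    fromℕ (rhs-denominator n) ℚ.* gSqCoeff n
      ≡⟨ ≡.cong₂ ℚ._*_ (≡.sym (closedDen-rhs-denominator n)) (gSqCoeff-square n) ⟩
    closedDen ⟨ fromℕ n ⟩ ℚ.* square-coeff gCoeff n
      ≡⟨ closed-form-square {gCoeff} ≡.refl (λ _ → ≡.refl) m ⟩
    (closedNum ⟨ fromℕ n ⟩ ℚ.- (closedDen ⟨ fromℕ n ⟩ ℚ.+ closedDen ⟨ fromℕ n ⟩)) ℚ.* t n
      ≡⟨ ≡.cong (ℚ._* t n) (closedNum-minus-twice-closedDen m) ⟩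
    fromℕ (rhs-numerator n) ℚ.* gCoeff n ∎
    where
    n : ℕ
    n = suc m

mainTheorem2 : (n : ℕ) → 1 ≤ n → .{{_ : NonZero (gCoeff n)}} →
    (gSqCoeff n ÷ gCoeff n) ≡ rhsRatio n
mainTheorem2 (suc m) _ =
  RationalEmbedding.÷-ι (rhs-numerator (suc m)) (rhs-denominator (suc m)) (gSqCoeff-cross-multiplied m)
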